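{- Every derivation in $\mathsf{IntQL}$ or in $\mathsf{IntQCL}$ of a labelled sequent $\Rightarrow w:\phi$ is a labelled tree derivation with the fixed root property: every labelled sequent occurring in it has a sequent graph that is a tree with root $w$.
   Context: Language: parameters, bound variables; $\phi::=p(\vec{\underline{a}})\mid\bot\mid\phi\wedge\phi\mid\phi\vee\phi\mid\phi\to\phi\mid\exists x\phi\mid\forall x\phi$. Labelled sequents $\mathcal{R},\Gamma\Rightarrow\Delta$: $\mathcal{R}$ a multiset of relational atoms $w\le u$, $\Gamma,\Delta$ multisets of labelled formulas $w:\phi$. Sequent graph: vertices the labels occurring in the sequent, directed edge $w\to u$ for each $w\le u\in\mathcal{R}$; it is a tree with root $w$ if there is a unique directed path from $w$ to every vertex. $u$ reachable from $w$: $u=w$ or $\mathcal{R}$ contains $w\le v_1,\dots,v_n\le u$; connected: linked by a chain of atoms in either direction. $\underline{a}$ is $S4$-available ($S5$-available) for $w$ if some $u:\psi\in\Gamma\cup\Delta$ contains $\underline{a}$ with $w$ reachable from $u$ (connected to $u$). Eigenvariable: not in the conclusion. Rules of $\mathsf{IntXL}$, $\mathsf{X}\in\{\mathsf{Q},\mathsf{QC}\}$: $(id_*)$: $\mathcal{R},\Gamma,w:p(\vec{\underline{a}})\Rightarrow u:p(\vec{\underline{a}}),\Delta$, $u$ reachable from $w$; $(\bot_l)$: $\mathcal{R},\Gamma,w:\bot\Rightarrow\Delta$; $(\wedge_l),(\wedge_r),(\vee_l),(\vee_r)$ standard at one label; $(\to_r)$: $\mathcal{R},w\le u,\Gamma,u:\phi\Rightarrow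 u:\psi,\Delta$ / $\mathcal{R},\Gamma\Rightarrow w:\phi\to\psi,\Delta$, $u$ eigenvariable; $(Pr_\to)$: $\mathcal{R},w:\phi\to\psi,\Gamma\Rightarrow\Delta,u:\phi$ and $\mathcal{R},w:\phi\to\psi,u:\psi,\Gamma\Rightarrow\Delta$ / $\mathcal{R},w:\phi\to\psi,\Gamma\Rightarrow\Delta$, $u$ reachable from $w$; $(\exists_r)$: $\mathcal{R},\Gamma\Rightarrow\Delta,w:\phi(\underline{a}/x),w:\exists x\phi$ / $\mathcal{R},\Gamma\Rightarrow\Delta,w:\exists x\phi$, $\underline{a}$ $S4$- ($\mathsf{Q}$) resp. $S5$-available ($\mathsf{QC}$) for $w$ or eigenvariable; $(\forall_l)$: $\mathcal{R},w:\forall x\phi,v:\phi(\underline{a}/x),\Gamma\Rightarrow\Delta$ / $\mathcal{R},w:\forall x\phi,\Gamma\Rightarrow\Delta$, $\underline{a}$ $S4$- ($\mathsf{Q}$) resp. $S5$-available ($\mathsf{QC}$) for $v$ or eigenvariable, $v$ reachable from $w$; $(\forall_r)$: $\mathcal{R},w\le u,\Gamma\Rightarrow u:\phi(\underline{a}/x),\Delta$ / $\mathcal{R},\Gamma\Rightarrow w:\forall x\phi,\Delta$, $\underline{a},u$ eigenvariables; $(\exists_l)$: $\mathcal{R},\Gamma,w:\phi(\underline{a}/x)\Rightarrow\Delta$ / $\mathcal{R},\Gamma,w:\exists x\phi\Rightarrow\Delta$, $\underline{a}$ eigenvariable. $\mathsf{IntQL}$: $\mathsf{X}=\mathsf{Q}$;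 $\mathsf{IntQCL}$: $\mathsf{X}=\mathsf{QC}$. -}

module Defs where

open import Data.Nat using (ℕ; zero; suc)
open import Data.Fin using (Fin; zero; suc)
open import Data.List using (List; []; _∷_; length; lookup; _++_; map)
open import Data.List.Membership.Propositional using (_∈_)
open import Data.List.Relation.Binary.Permutation.Propositional using (_↭_)
open import Data.List.Relation.Unary.Any using (Any)
open import Data.Product using (Σ; ∃; _×_; _,_; proj₁; proj₂)
open import Data.Sum using (_⊎_)
open import Relation.Binary.PropositionalEquality using (_≡_)
open import Relation.Nullary using (¬_)

-- Syntax: parameters (free, named by ℕ) and bound variables
-- (well-scoped de Bruijn indices).

Label : Set
Label = ℕ

Param : Set
Param = ℕ

PredSym : Set
PredSym = ℕ

data Term (n : ℕ) : Set where
  par : Param → Term n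
  bv  : Fin n → Term n

infixr 6 _∧̇_
infixr 5 _∨̇_
infixr 4 _⇒̇_

data Formula (n : ℕ) : Set where
  atom : PredSym → List (Term n) → Formula n
  ⊥̇    : Formula n
  _∧̇_  : Formula n → Formula n → Formula n
  _∨̇_  : Formula n → Formula n → Formula n
  _⇒̇_  : Formula n → Formula n → Formula n
  ∃̇    : Formula (suc n) → Formula n
  ∀̇    : Formula (suc n) → Formula n

wkT : ∀ {n} → Term n → Term (suc n)
wkT (par a) = par a
wkT (bv i)  = bv (suc i)

Subst : ℕ → ℕ → Set
Subst m n = Fin m → Term n

liftS : ∀ {m n} → Subst m n → Subst (suc m) (suc n)
liftS σ zero    = bv zero
liftS σ (suc i) = wkT (σ i)

substT : ∀ {m n} → Subst m n → Term m → Term n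
substT σ (par a) = par a
substT σ (bv i)  = σ i

substF : ∀ {m n} → Subst m n → Formula m → Formula n
substF σ (atom p ts) = atom p (map (substT σ) ts)
substF σ ⊥̇           = ⊥̇
substF σ (φ ∧̇ ψ)     = substF σ φ ∧̇ substF σ ψ
substF σ (φ ∨̇ ψ)     = substF σ φ ∨̇ substF σ ψ
substF σ (φ ⇒̇ ψ)     = substF σ φ ⇒̇ substF σ ψ
substF σ (∃̇ φ)       = ∃̇ (substF (liftS σ) φ)
substF σ (∀̇ φ)       = ∀̇ (substF (liftS σ) φ)

_[_] : Formula 1 → Param → Formula 0
φ [ a ] = substF (λ _ → par a) φ

data _occursIn_ (a : Param) : ∀ {n} → Formula n → Set where
  atm : ∀ {n p} {ts : List (Term n)} → Any (par a ≡_) ts → a occursIn atom p ts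
  ∧₁ : ∀ {n} {φ ψ : Formula n} → a occursIn φ → a occursIn (φ ∧̇ ψ)
  ∧₂ : ∀ {n} {φ ψ : Formula n} → a occursIn ψ → a occursIn (φ ∧̇ ψ)
  ∨₁ : ∀ {n} {φ ψ : Formula n} → a occursIn φ → a occursIn (φ ∨̇ ψ)
  ∨₂ : ∀ {n} {φ ψ : Formula n} → a occursIn ψ → a occursIn (φ ∨̇ ψ)
  ⇒₁ : ∀ {n} {φ ψ : Formula n} → a occursIn φ → a occursIn (φ ⇒̇ ψ)
  ⇒₂ : ∀ {n} {φ ψ : Formula n} → a occursIn ψ → a occursIn (φ ⇒̇ ψ)
  ∃o : ∀ {n} {φ : Formula (suc n)} → a occursIn φ → a occursIn ∃̇ φ
  ∀o : ∀ {n} {φ : Formula (suc n)} → a occursIn φ → a occursIn ∀̇ φ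

-- Labelled sequents  R, Γ ⇒ Δ  (multisets represented as lists,
-- identified up to permutation)

-- (w , u) represents the relational atom w ≤ u
RelAtom : Set
RelAtom = Label × Label

LFormula : Set
LFormula = Label × Formula 0

record Sequent : Set where
  constructor seq
  field
    rel : List RelAtom
    ant : List LFormula
    succ : List LFormula
open Sequent public

_≅_ : Sequent → Sequent → Set
S ≅ T = (rel S ↭ rel T) × (ant S ↭ ant T) × (succ S ↭ succ T)

data Reach (R : List RelAtom) : Label → Label → Set where
  here : ∀ {w} → Reach R w w
  step : ∀ {w v u} → (w , v) ∈ R → Reach R v u → Reach R w u

data Conn (R : List RelAtom) : Label → Label → Set where
  here : ∀ {w} → Conn R w w
  fwd  : ∀ {w v u} → (w , v) ∈ R → Conn R v u → Conn R w u
  bwd  : ∀ {w v u} → (v , w) ∈ R → Conn R v u → Conn R w u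

LabelIn : Label → Sequent → Set
LabelIn v S = Any (λ r → proj₁ r ≡ v ⊎ proj₂ r ≡ v) (rel S)
            ⊎ Any (λ f → proj₁ f ≡ v) (ant S ++ succ S)

ParIn : Param → Sequent → Set
ParIn a S = Any (λ f → a occursIn proj₂ f) (ant S ++ succ S)

data Mode : Set where
  Q QC : Mode

-- a is S4-available (Q) / S5-available (QC) for w in S
Available : Mode → Sequent → Param → Label → Set
Available Q  S a w = ∃ λ (f : LFormula) → f ∈ (ant S ++ succ S) × a occursIn proj₂ f × Reach (rel S) (proj₁ f) w
Available QC S a w = ∃ λ (f : LFormula) → f ∈ (ant S ++ succ S) × a occursIn proj₂ f × Conn (rel S) (proj₁ f) w

-- side condition of (∃r), (∀l): available, or an eigenvariable (not in conclusion S)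
ParCond : Mode → Sequent → Param → Label → Set
ParCond X S a w = Available X S a w ⊎ ¬ ParIn a S

-- Derivations in IntXL.  Each rule concludes any sequent S that is
-- (multiset-)equal to the rule's conclusion pattern.

data Deriv (X : Mode) : Sequent → Set where
  idr : ∀ {S R Γ Δ w u p ts} →
        S ≅ seq R ((w , atom p ts) ∷ Γ) ((u , atom p ts) ∷ Δ) →
        Reach R w u → Deriv X S
  ⊥l  : ∀ {S R Γ Δ w} → S ≅ seq R ((w , ⊥̇) ∷ Γ) Δ → Deriv X S
  ∧l  : ∀ {S R Γ Δ w φ ψ} → S ≅ seq R ((w , φ ∧̇ ψ) ∷ Γ) Δ →
        Deriv X (seq R ((w , φ) ∷ (w , ψ) ∷ Γ) Δ) → Deriv X S
  ∧r  : ∀ {S R Γ Δ w φ ψ} → S ≅ seq R Γ ((w , φ ∧̇ ψ) ∷ Δ) →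
        Deriv X (seq R Γ ((w , φ) ∷ Δ)) →
        Deriv X (seq R Γ ((w , ψ) ∷ Δ)) → Deriv X S
  ∨l  : ∀ {S R Γ Δ w φ ψ} → S ≅ seq R ((w , φ ∨̇ ψ) ∷ Γ) Δ →
        Deriv X (seq R ((w , φ) ∷ Γ) Δ) →
        Deriv X (seq R ((w , ψ) ∷ Γ) Δ) → Deriv X S
  ∨r  : ∀ {S R Γ Δ w φ ψ} → S ≅ seq R Γ ((w , φ ∨̇ ψ) ∷ Δ) →
        Deriv X (seq R Γ ((w , φ) ∷ (w , ψ) ∷ Δ)) → Deriv X S
  ⇒r  : ∀ {S R Γ Δ w u φ ψ} → S ≅ seq R Γ ((w , φ ⇒̇ ψ) ∷ Δ) →
        ¬ LabelIn u S →
        Deriv X (seq ((w , u) ∷ R) ((u , φ) ∷ Γ) ((u , ψ) ∷ Δ)) → Deriv X S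
  Pr⇒ : ∀ {S R Γ Δ w u φ ψ} → S ≅ seq R ((w , φ ⇒̇ ψ) ∷ Γ) Δ →
        Reach R w u →
        Deriv X (seq R ((w , φ ⇒̇ ψ) ∷ Γ) ((u , φ) ∷ Δ)) →
        Deriv X (seq R ((w , φ ⇒̇ ψ) ∷ (u , ψ) ∷ Γ) Δ) → Deriv X S
  ∃r  : ∀ {S R Γ Δ w φ a} → S ≅ seq R Γ ((w , ∃̇ φ) ∷ Δ) →
        ParCond X S a w →
        Deriv X (seq R Γ ((w , φ [ a ]) ∷ (w , ∃̇ φ) ∷ Δ)) → Deriv X S
  ∀l  : ∀ {S R Γ Δ w v φ a} → S ≅ seq R ((w , ∀̇ φ) ∷ Γ) Δ →
        Reach R w v → ParCond X S a v →
        Deriv X (seq R ((w , ∀̇ φ) ∷ (v , φ [ a ]) ∷ Γ) Δ) → Deriv X S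
  ∀r  : ∀ {S R Γ Δ w u φ a} → S ≅ seq R Γ ((w , ∀̇ φ) ∷ Δ) →
        ¬ ParIn a S → ¬ LabelIn u S →
        Deriv X (seq ((w , u) ∷ R) Γ ((u , φ [ a ]) ∷ Δ)) → Deriv X S
  ∃l  : ∀ {S R Γ Δ w φ a} → S ≅ seq R ((w , ∃̇ φ) ∷ Γ) Δ →
        ¬ ParIn a S →
        Deriv X (seq R ((w , φ [ a ]) ∷ Γ) Δ) → Deriv X S

Every : ∀ {X} (P : Sequent → Set) {S} → Deriv X S → Set
Every P {S} (idr _ _)         = P S
Every P {S} (⊥l _)            = P S
Every P {S} (∧l _ d)          = P S × Every P d
Every P {S} (∧r _ d e)        = P S × Every P d × Every P e
Every P {S} (∨l _ d e)        = P S × Every P d × Every P e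
Every P {S} (∨r _ d)          = P S × Every P d
Every P {S} (⇒r _ _ d)        = P S × Every P d
Every P {S} (Pr⇒ _ _ d e)     = P S × Every P d × Every P e
Every P {S} (∃r _ _ d)        = P S × Every P d
Every P {S} (∀l _ _ _ d)      = P S × Every P d
Every P {S} (∀r _ _ _ d)      = P S × Every P d
Every P {S} (∃l _ _ d)        = P S × Every P d

-- Sequent graph: vertices = labels of S, one directed edge per
-- occurrence of an atom w ≤ u in R (edges named by their position in R).

data PathIn (R : List RelAtom) : Label → Label → List (Fin (length R)) → Set where
  []  : ∀ {w} → PathIn R w w []
  _∷_ : ∀ {w v u is} (i : Fin (length R)) →
        lookup R i ≡ (w , v) × PathIn R v u is → PathIn R w u (i ∷ is)

IsTreeWithRoot : Label → Sequent → Set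
IsTreeWithRoot w S =
  ∀ v → LabelIn v S →
    (∃ λ is → PathIn (rel S) w v is) ×
    (∀ is js → PathIn (rel S) w v is → PathIn (rel S) w v js → is ≡ js)

-- Call a sequent rooted at r when every label in it is reachable from r, no
-- relational atom has target r, and no two relational atoms share a target.
-- A rooted sequent graph is a tree with root r: reachability gives a path to
-- every vertex, and a path from r is unique because, read backwards, every
-- vertex other than r has exactly one incoming edge.  The endsequent
-- ⇒ w : φ is rooted at w, and every rule preserves rootedness upwards: all
-- rules keep the relational atoms except (→r) and (∀r), which add one atom
-- w ≤ u whose source w is already reachable and whose target u is fresh.

module Submission where

open import Defs
open import Data.List using ([]; _∷_)
open import Data.Product using (_,_)

open import Data.Empty using (⊥-elim)
open import Data.Fin using (Fin; zero; suc)
open import Data.List using (List; length; lookup; map; _++_; _∷ʳ_; [_])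
open import Data.List.Properties using (++-identityʳ; ++-assoc)
open import Data.List.Membership.Propositional using (_∈_; _∉_; find)
open import Data.List.Membership.Propositional.Properties using (∈-lookup; ∈-map⁺; ∈-map⁻)
open import Data.List.Relation.Unary.All using (All; []; _∷_; head; tail)
  renaming (map to All-map; lookup to All-lookup)
open import Data.List.Relation.Unary.All.Properties using (¬Any⇒All¬; ++⁺)
open import Data.List.Relation.Unary.Any using (here; there; index)
  renaming (map to Any-map)
open import Data.List.Relation.Unary.Any.Properties using (lookup-index; ++⁺ʳ)
open import Data.List.Relation.Unary.Unique.Propositional using (Unique; []; _∷_)
open import Data.List.Relation.Binary.Permutation.Propositional using (_↭_; ↭-sym; ↭⇒↭ₛ)
open import Data.List.Relation.Binary.Permutation.Propositional.Properties
  using (All-resp-↭; Any-resp-↭; ∈-resp-↭; map⁺)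
  renaming (++⁺ to ↭-++⁺)
open import Relation.Binary.PropositionalEquality
  using (_≡_; refl; sym; trans; cong; subst; setoid)
open import Data.List.Relation.Binary.Permutation.Setoid.Properties (setoid Label)
  using (Unique-resp-↭)
open import Data.Product using (∃; _×_; proj₁; proj₂)
open import Data.Sum using (inj₁; inj₂)
open import Function using (_∘_)
open import Relation.Nullary using (¬_)

private
  variable
    X : Mode
    R R′ : List RelAtom
    Γ Γ′ Δ Δ′ : List LFormula
    S T : Sequent
    r u v w x y z : Label
    φ ψ χ : Formula 0

map-lookup-injective : ∀ {A B : Set} (f : A → B) (xs : List A) → Unique (map f xs) →
  ∀ i j → f (lookup xs i) ≡ f (lookup xs j) → i ≡ j
map-lookup-injective f (_ ∷ _)  _          zero    zero    _  = refl
map-lookup-injective f (_ ∷ _)  (fx∉ ∷ _)  zero    (suc j) eq =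
  ⊥-elim (All-lookup fx∉ (∈-map⁺ f (∈-lookup j)) eq)
map-lookup-injective f (_ ∷ _)  (fx∉ ∷ _)  (suc i) zero    eq =
  ⊥-elim (All-lookup fx∉ (∈-map⁺ f (∈-lookup i)) (sym eq))
map-lookup-injective f (_ ∷ xs) (_ ∷ uniq) (suc i) (suc j) eq =
  cong suc (map-lookup-injective f xs uniq i j eq)

targets : List RelAtom → List Label
targets = map proj₂

Reachable : {B : Set} → List RelAtom → Label → Label × B → Set
Reachable R r x = Reach R r (proj₁ x)

reach-trans : Reach R x y → Reach R y z → Reach R x z
reach-trans here         q = q
reach-trans (step e∈ p) q = step e∈ (reach-trans p q)

reach-weaken : ∀ {e} → Reach R x y → Reach (e ∷ R) x y
reach-weaken here         = here
reach-weaken (step e∈ p) = step (there e∈) (reach-weaken p)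

reach-resp-↭ : R ↭ R′ → Reach R x y → Reach R′ x y
reach-resp-↭ ρ here         = here
reach-resp-↭ ρ (step e∈ p) = step (∈-resp-↭ ρ e∈) (reach-resp-↭ ρ p)

reach⇒path : Reach R x y → ∃ (PathIn R x y)
reach⇒path here = [] , []
reach⇒path (step e∈ p) =
  let is , q = reach⇒path p in index e∈ ∷ is , index e∈ ∷ (sym (lookup-index e∈) , q)

-- PathIn grown at the far end, so that a path from the root is analysed by its last edge.
data PathFrom (R : List RelAtom) (r : Label) : Label → List (Fin (length R)) → Set where
  []   : PathFrom R r r []
  snoc : ∀ {u v is} → PathFrom R r u is →
         (k : Fin (length R)) → lookup R k ≡ (u , v) → PathFrom R r v (is ∷ʳ k)

pathFrom-++ : ∀ {is js} → PathFrom R r u is → PathIn R u v js → PathFrom R r v (is ++ js)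
pathFrom-++ {is = is} p [] = subst (PathFrom _ _ _) (sym (++-identityʳ is)) p
pathFrom-++ {is = is} p (_∷_ {is = js} k (e , q)) =
  subst (PathFrom _ _ _) (++-assoc is [ k ] js) (pathFrom-++ (snoc p k e) q)

pathIn⇒pathFrom : ∀ {is} → PathIn R r v is → PathFrom R r v is
pathIn⇒pathFrom = pathFrom-++ []

lookup-target : ∀ k → lookup R k ≡ (u , v) → v ∈ targets R
lookup-target k e = ∈-map⁺ proj₂ (subst (_∈ _) e (∈-lookup k))

pathFrom-unique : ∀ {is js} → r ∉ targets R → Unique (targets R) →
  PathFrom R r v is → PathFrom R r v js → is ≡ js
pathFrom-unique r∉ uniq []           []           = refl
pathFrom-unique r∉ uniq []           (snoc _ l e) = ⊥-elim (r∉ (lookup-target l e))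
pathFrom-unique r∉ uniq (snoc _ k e) []           = ⊥-elim (r∉ (lookup-target k e))
pathFrom-unique {R = R} r∉ uniq (snoc p k e) (snoc q l e′)
  with refl ← map-lookup-injective proj₂ R uniq k l (trans (cong proj₂ e) (cong proj₂ (sym e′)))
  with refl ← cong proj₁ (trans (sym e) e′)
  = cong (_∷ʳ k) (pathFrom-unique r∉ uniq p q)

record Rooted (r : Label) (S : Sequent) : Set where
  field
    sources-reachable : All (Reachable (rel S) r) (rel S)
    ant-reachable     : All (Reachable (rel S) r) (ant S)
    succ-reachable    : All (Reachable (rel S) r) (succ S)
    root-not-target   : r ∉ targets (rel S)
    targets-unique    : Unique (targets (rel S))
open Rooted

Rooted-resp-≅ : S ≅ T → Rooted r S → Rooted r T
Rooted-resp-≅ (ρ , α , β) I = record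
  { sources-reachable = All-resp-↭ ρ (All-map (reach-resp-↭ ρ) (sources-reachable I))
  ; ant-reachable     = All-resp-↭ α (All-map (reach-resp-↭ ρ) (ant-reachable I))
  ; succ-reachable    = All-resp-↭ β (All-map (reach-resp-↭ ρ) (succ-reachable I))
  ; root-not-target   = root-not-target I ∘ ∈-resp-↭ (map⁺ proj₂ (↭-sym ρ))
  ; targets-unique    = Unique-resp-↭ (↭⇒↭ₛ (map⁺ proj₂ ρ)) (targets-unique I)
  }

labels-reachable : Rooted r S → LabelIn v S → Reach (rel S) r v
labels-reachable I (inj₁ v∈R) with find v∈R
... | _ , e∈ , inj₁ refl = All-lookup (sources-reachable I) e∈
... | _ , e∈ , inj₂ refl = reach-trans (All-lookup (sources-reachable I) e∈) (step e∈ here)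
labels-reachable I (inj₂ v∈Γ,Δ) with find v∈Γ,Δ
... | _ , f∈ , refl = All-lookup (++⁺ (ant-reachable I) (succ-reachable I)) f∈

Rooted⇒IsTreeWithRoot : Rooted r S → IsTreeWithRoot r S
Rooted⇒IsTreeWithRoot I v v∈S =
  reach⇒path (labels-reachable I v∈S) ,
  λ is js p q → pathFrom-unique (root-not-target I) (targets-unique I)
                                (pathIn⇒pathFrom p) (pathIn⇒pathFrom q)

LabelIn-resp-≅ : S ≅ T → LabelIn v T → LabelIn v S
LabelIn-resp-≅ (ρ , α , β) (inj₁ v∈R)   = inj₁ (Any-resp-↭ (↭-sym ρ) v∈R)
LabelIn-resp-≅ (ρ , α , β) (inj₂ v∈Γ,Δ) = inj₂ (Any-resp-↭ (↭-sym (↭-++⁺ α β)) v∈Γ,Δ)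

target-LabelIn : v ∈ targets (rel S) → LabelIn v S
target-LabelIn v∈ with ∈-map⁻ proj₂ v∈
... | _ , e∈ , refl = inj₁ (Any-map (λ { refl → inj₂ refl }) e∈)

reach-LabelIn : Reach (rel S) x y → LabelIn y S → LabelIn x S
reach-LabelIn here         y∈S = y∈S
reach-LabelIn (step e∈ _) _   = inj₁ (Any-map (λ { refl → inj₁ refl }) e∈)

reformulate : Rooted r (seq R Γ Δ) →
  All (Reachable R r) Γ′ → All (Reachable R r) Δ′ → Rooted r (seq R Γ′ Δ′)
reformulate I Γ′↓ Δ′↓ = record
  { sources-reachable = sources-reachable I
  ; ant-reachable     = Γ′↓
  ; succ-reachable    = Δ′↓
  ; root-not-target   = root-not-target I
  ; targets-unique    = targets-unique I
  }

replace-ant-head : Rooted r (seq R ((w , φ) ∷ Γ) Δ) → Rooted r (seq R ((w , ψ) ∷ Γ) Δ)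
replace-ant-head I = reformulate I (head (ant-reachable I) ∷ tail (ant-reachable I)) (succ-reachable I)

split-ant-head : Rooted r (seq R ((w , φ) ∷ Γ) Δ) → Rooted r (seq R ((w , ψ) ∷ (w , χ) ∷ Γ) Δ)
split-ant-head I with ant-reachable I
... | w↓ ∷ Γ↓ = reformulate I (w↓ ∷ w↓ ∷ Γ↓) (succ-reachable I)

replace-succ-head : Rooted r (seq R Γ ((w , φ) ∷ Δ)) → Rooted r (seq R Γ ((w , ψ) ∷ Δ))
replace-succ-head I = reformulate I (ant-reachable I) (head (succ-reachable I) ∷ tail (succ-reachable I))

split-succ-head : Rooted r (seq R Γ ((w , φ) ∷ Δ)) → Rooted r (seq R Γ ((w , ψ) ∷ (w , χ) ∷ Δ))
split-succ-head I with succ-reachable I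
... | w↓ ∷ Δ↓ = reformulate I (ant-reachable I) (w↓ ∷ w↓ ∷ Δ↓)

extend-succ : Reach R w u → Rooted r (seq R ((w , χ) ∷ Γ) Δ) →
  Rooted r (seq R ((w , χ) ∷ Γ) ((u , φ) ∷ Δ))
extend-succ w↝u I =
  reformulate I (ant-reachable I) (reach-trans (head (ant-reachable I)) w↝u ∷ succ-reachable I)

extend-ant : Reach R w u → Rooted r (seq R ((w , χ) ∷ Γ) Δ) →
  Rooted r (seq R ((w , χ) ∷ (u , φ) ∷ Γ) Δ)
extend-ant w↝u I = reformulate I
  (head (ant-reachable I) ∷ reach-trans (head (ant-reachable I)) w↝u ∷ tail (ant-reachable I))
  (succ-reachable I)

add-ant-at-succ-head : Rooted r (seq R Γ ((u , ψ) ∷ Δ)) →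
  Rooted r (seq R ((u , φ) ∷ Γ) ((u , ψ) ∷ Δ))
add-ant-at-succ-head I =
  reformulate I (head (succ-reachable I) ∷ ant-reachable I) (succ-reachable I)

add-fresh-edge : ¬ LabelIn u (seq R Γ ((w , χ) ∷ Δ)) → Rooted r (seq R Γ ((w , χ) ∷ Δ)) →
  Rooted r (seq ((w , u) ∷ R) Γ ((u , ψ) ∷ Δ))
add-fresh-edge {u = u} {R = R} {Γ = Γ} {w = w} {χ = χ} {Δ = Δ} {r = r} u∉S I = record
  { sources-reachable = reach-weaken r↝w ∷ All-map reach-weaken (sources-reachable I)
  ; ant-reachable     = All-map reach-weaken (ant-reachable I)
  ; succ-reachable    = reach-trans (reach-weaken r↝w) (step (here refl) here)
                      ∷ All-map reach-weaken (tail (succ-reachable I))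
  ; root-not-target   = λ { (here refl) → u∉S (reach-LabelIn {S = S₀} r↝w w∈S)
                          ; (there r∈)  → root-not-target I r∈ }
  ; targets-unique    = ¬Any⇒All¬ _ (u∉S ∘ target-LabelIn {S = S₀}) ∷ targets-unique I
  }
  where
  S₀ : Sequent
  S₀ = seq R Γ ((w , χ) ∷ Δ)
  r↝w : Reach R r w
  r↝w = head (succ-reachable I)
  w∈S : LabelIn w S₀
  w∈S = inj₂ (++⁺ʳ Γ (here refl))

Rooted⇒Every : Rooted r S → (d : Deriv X S) → Every (IsTreeWithRoot r) d
Rooted⇒Every I (idr _ _) = Rooted⇒IsTreeWithRoot I
Rooted⇒Every I (⊥l _)    = Rooted⇒IsTreeWithRoot I
Rooted⇒Every I (∧l S≅ d) =
  Rooted⇒IsTreeWithRoot I , Rooted⇒Every (split-ant-head (Rooted-resp-≅ S≅ I)) d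
Rooted⇒Every I (∧r S≅ d e) =
  Rooted⇒IsTreeWithRoot I , Rooted⇒Every (replace-succ-head (Rooted-resp-≅ S≅ I)) d ,
  Rooted⇒Every (replace-succ-head (Rooted-resp-≅ S≅ I)) e
Rooted⇒Every I (∨l S≅ d e) =
  Rooted⇒IsTreeWithRoot I , Rooted⇒Every (replace-ant-head (Rooted-resp-≅ S≅ I)) d ,
  Rooted⇒Every (replace-ant-head (Rooted-resp-≅ S≅ I)) e
Rooted⇒Every I (∨r S≅ d) =
  Rooted⇒IsTreeWithRoot I , Rooted⇒Every (split-succ-head (Rooted-resp-≅ S≅ I)) d
Rooted⇒Every I (⇒r S≅ u∉S d) =
  Rooted⇒IsTreeWithRoot I ,
  Rooted⇒Every
    (add-ant-at-succ-head (add-fresh-edge (u∉S ∘ LabelIn-resp-≅ S≅) (Rooted-resp-≅ S≅ I))) d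
Rooted⇒Every I (Pr⇒ S≅ w↝u d e) =
  Rooted⇒IsTreeWithRoot I , Rooted⇒Every (extend-succ w↝u (Rooted-resp-≅ S≅ I)) d ,
  Rooted⇒Every (extend-ant w↝u (Rooted-resp-≅ S≅ I)) e
Rooted⇒Every I (∃r S≅ _ d) =
  Rooted⇒IsTreeWithRoot I , Rooted⇒Every (split-succ-head (Rooted-resp-≅ S≅ I)) d
Rooted⇒Every I (∀l S≅ w↝v _ d) =
  Rooted⇒IsTreeWithRoot I , Rooted⇒Every (extend-ant w↝v (Rooted-resp-≅ S≅ I)) d
Rooted⇒Every I (∀r S≅ _ u∉S d) =
  Rooted⇒IsTreeWithRoot I ,
  Rooted⇒Every (add-fresh-edge (u∉S ∘ LabelIn-resp-≅ S≅) (Rooted-resp-≅ S≅ I)) d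
Rooted⇒Every I (∃l S≅ _ d) =
  Rooted⇒IsTreeWithRoot I , Rooted⇒Every (replace-ant-head (Rooted-resp-≅ S≅ I)) d

mainTheorem9 : (X : Mode) (w : Label) (φ : Formula 0)
    (d : Deriv X (seq [] [] ((w , φ) ∷ []))) →
    Every (IsTreeWithRoot w) d
mainTheorem9 X w φ d = Rooted⇒Every endsequent-rooted d
  where
  endsequent-rooted : Rooted w (seq [] [] ((w , φ) ∷ []))
  endsequent-rooted = record
    { sources-reachable = []
    ; ant-reachable     = []
    ; succ-reachable    = here ∷ []
    ; root-not-target   = λ ()
    ; targets-unique    = []
    }
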